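{- Let $d$ be a positive integer, let $G$ be a simple graph which has a connected subgraph $G'$ with $d-1$ vertices, and let $\mathcal{H}=\{H_x\}_{x\in V(G)}$ be a family of simple graphs indexed by $V(G)$ with pairwise disjoint vertex sets (also disjoint from $V(G)$) such that $\bigcup_{x\in V(G')}V(H_x)$ contains a $1$-independent subset with three elements. Then the corona $G\circ\mathcal{H}$ is not $d$-unit interval.
   Context: The corona $G\circ\mathcal{H}$ is the disjoint union of $G$ and all $H_x$, together with additional edges joining each vertex $x$ of $G$ to all vertices of $H_x$. A $1$-independent set is a set of pairwise nonadjacent vertices. For a graph $K$ with $m$ vertices, $\Delta_d(K)$ is the simplicial complex on $V(K)$ whose facets are the $(d+1)$-subsets $U$ with $K[U]$ connected; $K$ is $d$-unit interval if there is a bijection $V(K)\to[m]$ (vertices identified with labels) such that for each facet $\{i_1<\dots<i_{d+1}\}$ of $\Delta_d(K)$, every $\{j_1,\dots,j_{d+1}\}$ with $i_1\leq j_1<\dots<j_{d+1}\leq i_{d+1}$ is a facet. -}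

module Defs where

open import Data.Nat using (ℕ; zero; suc)
open import Data.Bool using (Bool; true; false)
open import Data.Fin using (Fin; _<_; _≤_; fromℕ)
open import Data.Product using (Σ; _,_; _×_; ∃; ∃-syntax; proj₁)
open import Data.Sum using (_⊎_; inj₁; inj₂)
open import Relation.Binary.PropositionalEquality using (_≡_)
open import Relation.Binary.Construct.Closure.ReflexiveTransitive using (Star)
open import Relation.Nullary using (¬_)
open import Function using (_∘_)
open import Function.Bundles using (_⤖_; Bijection)
open import Function.Definitions using (Injective)

record Graph (n : ℕ) : Set where
  field
    adj   : Fin n → Fin n → Bool
    sym   : ∀ x y → adj x y ≡ adj y x
    irrefl : ∀ x → adj x x ≡ false
open Graph public

Adjacent : ∀ {n} → Graph n → Fin n → Fin n → Set
Adjacent G x y = adj G x y ≡ true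

record ConnectedSubgraph {n : ℕ} (G : Graph n) (k : ℕ) : Set₁ where
  field
    vertex    : Fin k → Fin n
    vertexInj : Injective _≡_ _≡_ vertex
    edge      : Fin k → Fin k → Set
    edge⊆     : ∀ p q → edge p q → Adjacent G (vertex p) (vertex q)
    connected : ∀ p q → Star edge p q
open ConnectedSubgraph public

-- Vertex set of the corona G ∘ H: disjoint union of V(G) and all V(H_x)
-- (disjointness is built in by tagging).
CVertex : (n : ℕ) → (Fin n → ℕ) → Set
CVertex n m = Fin n ⊎ Σ (Fin n) (λ x → Fin (m x))

data CoronaAdj {n : ℕ} (G : Graph n) {m : Fin n → ℕ} (H : (x : Fin n) → Graph (m x))
     : CVertex n m → CVertex n m → Set where
  base    : ∀ {x y} → Adjacent G x y → CoronaAdj G H (inj₁ x) (inj₁ y)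
  attachˡ : ∀ {x u} → CoronaAdj G H (inj₁ x) (inj₂ (x , u))
  attachʳ : ∀ {x u} → CoronaAdj G H (inj₂ (x , u)) (inj₁ x)
  fiber   : ∀ {x u v} → Adjacent (H x) u v → CoronaAdj G H (inj₂ (x , u)) (inj₂ (x , v))

module _ {V : Set} (E : V → V → Set) where

  InducedConnected : ∀ {k} → (Fin k → V) → Set
  InducedConnected {k} S = ∀ a b → Star (λ p q → E (S p) (S q)) a b

  StrictlyIncreasing : ∀ {k m} → (Fin k → Fin m) → Set
  StrictlyIncreasing i = ∀ a b → a < b → i a < i b

  -- Given a labelling (bijection) lab : Fin m ⤖ V, the label set
  -- {i_1 < ... < i_{d+1}} (i strictly increasing) is a facet of Δ_d(K).
  IsFacet : ∀ {m} (lab : Fin m ⤖ V) (d : ℕ) → (Fin (suc d) → Fin m) → Set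
  IsFacet lab d i = StrictlyIncreasing i × InducedConnected (Bijection.to lab ∘ i)

  UnitInterval : ℕ → Set
  UnitInterval d =
    Σ ℕ λ m → Σ (Fin m ⤖ V) λ lab →
      ∀ (i j : Fin (suc d) → Fin m) →
        IsFacet lab d i →
        StrictlyIncreasing j →
        i Fin.zero ≤ j Fin.zero →
        j (fromℕ d) ≤ i (fromℕ d) →
        IsFacet lab d j

-- Write d = |V(G′)| + 1 ≥ 2 and order the three fibre vertices by label as
-- w₀ < w₁ < w₂. The set U = V(G′) ∪ {w₀, w₂} has d + 1 elements and is connected,
-- since w₀ and w₂ hang off vertices of G′. Replacing in U the base vertex of w₀
-- by w₁ gives a (d + 1)-set whose labels all lie in the label range of U, so a
-- d-unit-interval labelling forces it to be connected too; but w₀ has no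
-- neighbour in it, its only neighbours outside its fibre being its base.
module Submission where

open import Defs
open import Data.Nat using (ℕ; _∸_) renaming (_≤_ to _≤ℕ_)
open import Data.Fin using (Fin)
open import Data.Product using (Σ; ∃; _,_; proj₁)
open import Data.Sum using (inj₂)
open import Relation.Binary.PropositionalEquality using (_≡_)
open import Relation.Nullary using (¬_)
open import Function.Definitions using (Injective)

open import Data.Nat as ℕ using (zero; suc; s≤s; z≤n)
import Data.Nat.Properties as ℕₚ
open import Data.Fin using (zero; suc; _<_; _≤_; cast; fromℕ; punchIn)
import Data.Fin.Properties as Finₚ
open import Data.Vec.Functional using (_∷_)
open import Data.List using (List; length; lookup; tabulate)
open import Data.List.Properties using (length-tabulate)
open import Data.List.Relation.Unary.AllPairs as AllPairs using (AllPairs)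
import Data.List.Relation.Unary.All as All
import Data.List.Relation.Unary.Any as Any
open import Data.List.Relation.Unary.Any.Properties using (lookup-index)
open import Data.List.Relation.Unary.Unique.Propositional using (Unique)
open import Data.List.Relation.Unary.Unique.Propositional.Properties using (tabulate⁺)
open import Data.List.Membership.Propositional using (_∈_)
open import Data.List.Membership.Propositional.Properties using (∈-lookup; ∈-tabulate⁺; ∈-tabulate⁻)
open import Data.List.Relation.Binary.Permutation.Propositional using (↭-sym; ↭⇒↭ₛ)
open import Data.List.Relation.Binary.Permutation.Propositional.Properties using (↭-length; ∈-resp-↭)
import Data.List.Relation.Binary.Permutation.Setoid.Properties as Permutationₛ
open import Data.List.Relation.Unary.Sorted.TotalOrder.Properties using (lookup-mono-≤)
open import Data.Product using (∃₂; _×_; proj₂)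
open import Data.Sum using (inj₁)
open import Data.Sum.Properties using (inj₁-injective; inj₂-injective)
open import Data.Empty using (⊥)
open import Function using (_∘_; id)
open import Function.Bundles using (_⤖_; Bijection; Surjection)
open import Relation.Binary.Definitions using (Symmetric; tri<; tri≈; tri>)
open import Relation.Binary.PropositionalEquality
  using (refl; trans; cong; subst₂; setoid; _≢_)
import Relation.Binary.PropositionalEquality as ≡
open import Relation.Binary.Construct.Closure.ReflexiveTransitive
  using (Star; ε; _◅_; gmap; reverse)
open import Relation.Nullary using (contradiction)

_⊆ᵢ_ : ∀ {A : Set} {k l} → (Fin k → A) → (Fin l → A) → Set
f ⊆ᵢ g = ∀ a → ∃ λ b → f a ≡ g b

Increasing : ∀ {k M} → (Fin k → Fin M) → Set
Increasing g = ∀ a b → a < b → g a < g b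

Increasing⇒Injective : ∀ {k M} {g : Fin k → Fin M} → Increasing g → Injective _≡_ _≡_ g
Increasing⇒Injective g-inc {a} {b} ga≡gb with Finₚ.<-cmp a b
... | tri< a<b _ _ = contradiction ga≡gb (Finₚ.<⇒≢ (g-inc a b a<b))
... | tri≈ _ a≡b _ = a≡b
... | tri> _ _ b<a = contradiction (≡.sym ga≡gb) (Finₚ.<⇒≢ (g-inc b a b<a))

Increasing⇒Monotone : ∀ {k M} {g : Fin k → Fin M} → Increasing g → ∀ {a b} → a ≤ b → g a ≤ g b
Increasing⇒Monotone {g = g} g-inc {a} {b} a≤b with ℕₚ.m≤n⇒m<n∨m≡n a≤b
... | inj₁ a<b = ℕₚ.<⇒≤ (g-inc a b a<b)
... | inj₂ a≡b = Finₚ.≤-reflexive (cong g (Finₚ.toℕ-injective a≡b))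

AllPairs-lookup : ∀ {A : Set} {R : A → A → Set} {xs} → AllPairs R xs →
  ∀ {i j} → i < j → R (lookup xs i) (lookup xs j)
AllPairs-lookup (x~xs AllPairs.∷ _) {zero}  {suc j} _         = All.lookup x~xs (∈-lookup j)
AllPairs-lookup (_ AllPairs.∷ xs!) {suc i} {suc j} (s≤s i<j) = AllPairs-lookup xs! i<j

-- The sorted list of values is a permutation of them, so it still has length k
-- and distinct entries.
sortedEnumeration : ∀ {k M} (f : Fin k → Fin M) → Injective _≡_ _≡_ f →
  Σ (Fin k → Fin M) λ g → Increasing g × g ⊆ᵢ f × f ⊆ᵢ g
sortedEnumeration {k} {M} f f-inj = g , g-increasing , g⊆f , f⊆g
  where
  open import Data.List.Sort (Finₚ.≤-decTotalOrder M) using (sort; sort-↭; sort-↗)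

  sorted : List (Fin M)
  sorted = sort (tabulate f)

  length-sorted : length sorted ≡ k
  length-sorted = trans (↭-length (sort-↭ (tabulate f))) (length-tabulate f)

  sorted-unique : Unique sorted
  sorted-unique = Permutationₛ.Unique-resp-↭ (setoid (Fin M))
    (↭⇒↭ₛ (↭-sym (sort-↭ (tabulate f)))) (tabulate⁺ f-inj)

  position : Fin k → Fin (length sorted)
  position = cast (≡.sym length-sorted)

  g : Fin k → Fin M
  g = lookup sorted ∘ position

  g-increasing : Increasing g
  g-increasing a b a<b = Finₚ.≤∧≢⇒<
    (lookup-mono-≤ (Finₚ.≤-totalOrder M) (sort-↗ (tabulate f)) (ℕₚ.<⇒≤ pa<pb))
    (AllPairs-lookup sorted-unique pa<pb)
    where
    pa<pb : position a < position b
    pa<pb = subst₂ ℕ._<_ (≡.sym (Finₚ.toℕ-cast _ a)) (≡.sym (Finₚ.toℕ-cast _ b)) a<b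

  g⊆f : g ⊆ᵢ f
  g⊆f a = ∈-tabulate⁻ (∈-resp-↭ (sort-↭ (tabulate f)) (∈-lookup (position a)))

  f⊆g : f ⊆ᵢ g
  f⊆g b = cast length-sorted (Any.index fb∈sorted) ,
    trans (lookup-index fb∈sorted)
          (cong (lookup sorted) (≡.sym (Finₚ.cast-involutive (≡.sym length-sorted) length-sorted _)))
    where
    fb∈sorted : f b ∈ sorted
    fb∈sorted = ∈-resp-↭ (↭-sym (sort-↭ (tabulate f))) (∈-tabulate⁺ b)

∷-injective : ∀ {A : Set} {k} {x : A} {f : Fin k → A} →
  (∀ c → x ≢ f c) → Injective _≡_ _≡_ f → Injective _≡_ _≡_ (x ∷ f)
∷-injective x∉f f-inj {zero}  {zero}  _   = refl
∷-injective x∉f f-inj {zero}  {suc c} eq  = contradiction eq (x∉f c)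
∷-injective x∉f f-inj {suc c} {zero}  eq  = contradiction (≡.sym eq) (x∉f c)
∷-injective x∉f f-inj {suc c} {suc c′} eq = cong suc (f-inj eq)

∉-∷ : ∀ {A : Set} {k} {x y : A} {f : Fin k → A} →
  x ≢ y → (∀ c → x ≢ f c) → ∀ c → x ≢ (y ∷ f) c
∉-∷ x≢y x∉f zero    = x≢y
∉-∷ x≢y x∉f (suc c) = x∉f c

module _ {V : Set} (E : V → V → Set) where

  InducedConnected-reindex : ∀ {k l} {f : Fin k → V} {g : Fin l → V} →
    Injective _≡_ _≡_ g → g ⊆ᵢ f → f ⊆ᵢ g → InducedConnected E f → InducedConnected E g
  InducedConnected-reindex {k} {l} {f} {g} g-inj g⊆f f⊆g f-connected a a′ =
    subst₂ (Star _) (σ-section a) (σ-section a′) (gmap σ step (f-connected _ _))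
    where
    σ : Fin k → Fin l
    σ b = proj₁ (f⊆g b)

    step : ∀ {b b′} → E (f b) (f b′) → E (g (σ b)) (g (σ b′))
    step = subst₂ E (proj₂ (f⊆g _)) (proj₂ (f⊆g _))

    σ-section : ∀ a → σ (proj₁ (g⊆f a)) ≡ a
    σ-section a = g-inj (≡.sym (trans (proj₂ (g⊆f a)) (proj₂ (f⊆g _))))

  InducedConnected-∷ : Symmetric E → ∀ {k x} {f : Fin k → V} {b} →
    E x (f b) → InducedConnected E f → InducedConnected E (x ∷ f)
  InducedConnected-∷ E-sym {x = x} {f} {b} x~fb f-connected = x∷f-connected
    where
    lift : ∀ {c c′} → Star (λ p q → E (f p) (f q)) c c′ →
           Star (λ p q → E ((x ∷ f) p) ((x ∷ f) q)) (suc c) (suc c′)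
    lift = gmap suc id

    fromHead : ∀ c → Star (λ p q → E ((x ∷ f) p) ((x ∷ f) q)) zero (suc c)
    fromHead c = x~fb ◅ lift (f-connected b c)

    x∷f-connected : InducedConnected E (x ∷ f)
    x∷f-connected zero    zero     = ε
    x∷f-connected zero    (suc c′) = fromHead c′
    x∷f-connected (suc c) zero     = reverse E-sym (fromHead c)
    x∷f-connected (suc c) (suc c′) = lift (f-connected c c′)

  isolated⇒¬InducedConnected : ∀ {k} {f : Fin (suc (suc k)) → V} a →
    (∀ c → ¬ E (f a) (f c)) → ¬ InducedConnected E f
  isolated⇒¬InducedConnected {f = f} a isolated f-connected =
    leaves (f-connected a (punchIn a zero)) (Finₚ.punchInᵢ≢i a zero ∘ ≡.sym)
    where
    leaves : ∀ {b} → Star (λ p q → E (f p) (f q)) a b → a ≢ b → ⊥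
    leaves ε       a≢a = a≢a refl
    leaves (e ◅ _) _   = isolated _ e

UnitIntervalLabelling : ∀ {V : Set} (E : V → V → Set) {M} → Fin M ⤖ V → ℕ → Set
UnitIntervalLabelling E {M} lab d =
  ∀ (i j : Fin (suc d) → Fin M) →
    IsFacet E lab d i →
    StrictlyIncreasing E j →
    i zero ≤ j zero →
    j (fromℕ d) ≤ i (fromℕ d) →
    IsFacet E lab d j

module Labelling {V : Set} {M} (lab : Fin M ⤖ V) where

  open Bijection lab using (to; injective; surjection)
  open Surjection surjection using (to∘to⁻)

  label : V → Fin M
  label = Bijection.to⁻ lab

  label-injective : Injective _≡_ _≡_ label
  label-injective {v} {w} eq = trans (≡.sym (to∘to⁻ v)) (trans (cong to eq) (to∘to⁻ w))

  -- The unit-interval condition for vertex sets rather than increasing label sequences.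
  InducedConnected-between : ∀ (E : V → V → Set) {d} → UnitIntervalLabelling E lab d →
    ∀ (f h : Fin (suc d) → V) →
    Injective _≡_ _≡_ f → Injective _≡_ _≡_ h → InducedConnected E f →
    (∀ c → ∃₂ λ a b → label (f a) ≤ label (h c) × label (h c) ≤ label (f b)) →
    InducedConnected E h
  InducedConnected-between E {d} unitInterval f h f-inj h-inj f-connected between
    with sortedEnumeration (label ∘ f) (f-inj ∘ label-injective)
       | sortedEnumeration (label ∘ h) (h-inj ∘ label-injective)
  ... | i , i-inc , i⊆f , f⊆i | j , j-inc , j⊆h , h⊆j =
    InducedConnected-reindex E h-inj (unlabel⊇ h⊆j) (unlabel⊆ j⊆h)
      (proj₂ (unitInterval i j (i-inc , i-connected) j-inc lower upper))
    where
    unlabel⊆ : ∀ {k l} {i : Fin k → Fin M} {f : Fin l → V} → i ⊆ᵢ (label ∘ f) → (to ∘ i) ⊆ᵢ f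
    unlabel⊆ i⊆f a = proj₁ (i⊆f a) , trans (cong to (proj₂ (i⊆f a))) (to∘to⁻ _)

    unlabel⊇ : ∀ {k l} {i : Fin k → Fin M} {f : Fin l → V} → (label ∘ f) ⊆ᵢ i → f ⊆ᵢ (to ∘ i)
    unlabel⊇ f⊆i b = proj₁ (f⊆i b) , trans (≡.sym (to∘to⁻ _)) (cong to (proj₂ (f⊆i b)))

    i-connected : InducedConnected E (to ∘ i)
    i-connected = InducedConnected-reindex E (Increasing⇒Injective i-inc ∘ injective)
      (unlabel⊆ i⊆f) (unlabel⊇ f⊆i) f-connected

    lower : i zero ≤ j zero
    lower with j⊆h zero
    ... | c , j₀≡hc with between c
    ... | a , _ , fa≤hc , _ with f⊆i a
    ... | a′ , fa≡ia′ = begin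
      i zero       ≤⟨ Increasing⇒Monotone i-inc z≤n ⟩
      i a′         ≡⟨ fa≡ia′ ⟨
      label (f a)  ≤⟨ fa≤hc ⟩
      label (h c)  ≡⟨ j₀≡hc ⟨
      j zero       ∎
      where open import Relation.Binary.Reasoning.PartialOrder (Finₚ.≤-poset M)

    upper : j (fromℕ d) ≤ i (fromℕ d)
    upper with j⊆h (fromℕ d)
    ... | c , jₗ≡hc with between c
    ... | _ , b , _ , hc≤fb with f⊆i b
    ... | b′ , fb≡ib′ = begin
      j (fromℕ d)  ≡⟨ jₗ≡hc ⟩
      label (h c)  ≤⟨ hc≤fb ⟩
      label (f b)  ≡⟨ fb≡ib′ ⟩
      i b′         ≤⟨ Increasing⇒Monotone i-inc (Finₚ.≤fromℕ b′) ⟩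
      i (fromℕ d)  ∎
      where open import Relation.Binary.Reasoning.PartialOrder (Finₚ.≤-poset M)

open Labelling using (label; label-injective; InducedConnected-between)

module Corona {n : ℕ} (G : Graph n) {m : Fin n → ℕ} (H : (x : Fin n) → Graph (m x)) where

  CoronaAdj-sym : Symmetric (CoronaAdj G H)
  CoronaAdj-sym (base {x} {y} x~y)      = base (trans (Graph.sym G y x) x~y)
  CoronaAdj-sym attachˡ                 = attachʳ
  CoronaAdj-sym attachʳ                 = attachˡ
  CoronaAdj-sym (fiber {x} {u} {v} u~v) = fiber (trans (Graph.sym (H x) v u) u~v)

  CoronaAdj-irrefl : ∀ v → ¬ CoronaAdj G H v v
  CoronaAdj-irrefl (inj₁ x)       (base x~x)  with trans (≡.sym x~x) (irrefl G x)
  ... | ()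
  CoronaAdj-irrefl (inj₂ (x , u)) (fiber u~u) with trans (≡.sym u~u) (irrefl (H x) u)
  ... | ()

  attach : ∀ {w y} → proj₁ w ≡ y → CoronaAdj G H (inj₂ w) (inj₁ y)
  attach refl = attachʳ

  attach⁻¹ : ∀ {w y} → CoronaAdj G H (inj₂ w) (inj₁ y) → y ≡ proj₁ w
  attach⁻¹ attachʳ = refl

  ConnectedSubgraph⇒InducedConnected : ∀ {k} (G′ : ConnectedSubgraph G k) →
    InducedConnected (CoronaAdj G H) (inj₁ ∘ vertex G′)
  ConnectedSubgraph⇒InducedConnected G′ p q = gmap id (base ∘ edge⊆ G′ _ _) (connected G′ p q)

  fibre-label-not-between : ∀ {e M} (G′ : ConnectedSubgraph G (suc e)) (lab : Fin M ⤖ CVertex n m) →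
    UnitIntervalLabelling (CoronaAdj G H) lab (suc (suc e)) →
    ∀ {w₀ w₁ w₂ p₀ p₂} → proj₁ w₀ ≡ vertex G′ p₀ → proj₁ w₂ ≡ vertex G′ p₂ →
    ¬ CoronaAdj G H (inj₂ w₀) (inj₂ w₁) → ¬ CoronaAdj G H (inj₂ w₀) (inj₂ w₂) →
    label lab (inj₂ w₀) < label lab (inj₂ w₁) → label lab (inj₂ w₁) < label lab (inj₂ w₂) → ⊥
  fibre-label-not-between {e} G′ lab unitInterval {w₀} {w₁} {w₂} {p₀} {p₂} over₀ over₂ w₀≁w₁ w₀≁w₂ w₀<w₁ w₁<w₂ =
    isolated⇒¬InducedConnected (CoronaAdj G H) zero w₀-isolated
      (InducedConnected-between lab (CoronaAdj G H) unitInterval facet other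
        facet-injective other-injective facet-connected other-between)
    where
    base-of : ∀ {k} → (Fin k → Fin (suc e)) → Fin k → CVertex n m
    base-of φ = inj₁ ∘ vertex G′ ∘ φ

    facet other : Fin (suc (suc (suc e))) → CVertex n m
    facet = inj₂ w₀ ∷ inj₂ w₂ ∷ base-of id
    other = inj₂ w₀ ∷ inj₂ w₁ ∷ inj₂ w₂ ∷ base-of (punchIn p₀)

    base-of-injective : ∀ {k} {φ : Fin k → Fin (suc e)} → Injective _≡_ _≡_ φ → Injective _≡_ _≡_ (base-of φ)
    base-of-injective φ-inj = φ-inj ∘ vertexInj G′ ∘ inj₁-injective

    fibre∉base : ∀ {k w} {φ : Fin k → Fin (suc e)} c → inj₂ w ≢ base-of φ c
    fibre∉base _ ()

    distinct : ∀ {v v′} → label lab v < label lab v′ → v ≢ v′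
    distinct v<v′ v≡v′ = Finₚ.<⇒≢ v<v′ (cong (label lab) v≡v′)

    facet-injective : Injective _≡_ _≡_ facet
    facet-injective =
      ∷-injective (∉-∷ (distinct (Finₚ.<-trans w₀<w₁ w₁<w₂)) fibre∉base)
        (∷-injective fibre∉base (base-of-injective id))

    other-injective : Injective _≡_ _≡_ other
    other-injective =
      ∷-injective (∉-∷ (distinct w₀<w₁) (∉-∷ (distinct (Finₚ.<-trans w₀<w₁ w₁<w₂)) fibre∉base))
        (∷-injective (∉-∷ (distinct w₁<w₂) fibre∉base)
          (∷-injective fibre∉base (base-of-injective (Finₚ.punchIn-injective p₀ _ _))))

    facet-connected : InducedConnected (CoronaAdj G H) facet
    facet-connected =
      InducedConnected-∷ (CoronaAdj G H) CoronaAdj-sym {b = suc p₀} (attach over₀)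
        (InducedConnected-∷ (CoronaAdj G H) CoronaAdj-sym {b = p₂} (attach over₂)
          (ConnectedSubgraph⇒InducedConnected G′))

    w₀-isolated : ∀ c → ¬ CoronaAdj G H (inj₂ w₀) (other c)
    w₀-isolated zero                    = CoronaAdj-irrefl _
    w₀-isolated (suc zero)              = w₀≁w₁
    w₀-isolated (suc (suc zero))        = w₀≁w₂
    w₀-isolated (suc (suc (suc q))) w₀~ =
      Finₚ.punchInᵢ≢i p₀ q (vertexInj G′ (trans (attach⁻¹ w₀~) over₀))

    other-between : ∀ c → ∃₂ λ a b →
      label lab (facet a) ≤ label lab (other c) × label lab (other c) ≤ label lab (facet b)
    other-between zero                = zero , zero , Finₚ.≤-refl , Finₚ.≤-refl
    other-between (suc zero)          = zero , suc zero , ℕₚ.<⇒≤ w₀<w₁ , ℕₚ.<⇒≤ w₁<w₂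
    other-between (suc (suc zero))    = suc zero , suc zero , Finₚ.≤-refl , Finₚ.≤-refl
    other-between (suc (suc (suc q))) =
      suc (suc (punchIn p₀ q)) , suc (suc (punchIn p₀ q)) , Finₚ.≤-refl , Finₚ.≤-refl

corollary4p5 : (d : ℕ) → 1 ≤ℕ d →
    (n : ℕ) (G : Graph n) →
    (G' : ConnectedSubgraph G (d ∸ 1)) →
    (m : Fin n → ℕ) (H : (x : Fin n) → Graph (m x)) →
    (s : Fin 3 → Σ (Fin n) (λ x → Fin (m x))) →
    Injective _≡_ _≡_ s →
    (∀ a → ∃ λ p → proj₁ (s a) ≡ vertex G' p) →
    (∀ a b → ¬ CoronaAdj G H (inj₂ (s a)) (inj₂ (s b))) →
    ¬ UnitInterval (CoronaAdj G H) d
corollary4p5 (suc zero) _ n G G' m H s _ over _ _ with over zero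
... | () , _
corollary4p5 (suc (suc e)) _ n G G' m H s s-inj over nonadjacent (M , lab , unitInterval)
  with sortedEnumeration (label lab ∘ inj₂ ∘ s) (s-inj ∘ inj₂-injective ∘ label-injective lab)
... | g , g-increasing , g⊆labels , _ =
  Corona.fibre-label-not-between G H G' lab unitInterval
    (proj₂ (over (σ 0F))) (proj₂ (over (σ 2F))) (nonadjacent _ _) (nonadjacent _ _)
    (ordered 0F 1F (s≤s z≤n)) (ordered 1F 2F (s≤s (s≤s z≤n)))
  where
  open import Data.Fin.Patterns using (0F; 1F; 2F)

  σ : Fin 3 → Fin 3
  σ a = proj₁ (g⊆labels a)

  ordered : ∀ a b → a < b → label lab (inj₂ (s (σ a))) < label lab (inj₂ (s (σ b)))
  ordered a b a<b = subst₂ _<_ (proj₂ (g⊆labels a)) (proj₂ (g⊆labels b)) (g-increasing a b a<b)
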